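{- Let $\pi$ be a QBAL proof of $\Phi;\Gamma\vdash B$ and let $\Psi$ be a constraint set with $\Psi\models\Phi$. Then there is a QBAL proof $\rho$ of $\Psi;\Gamma\vdash B$ such that $\lfloor\rho\rfloor=\lfloor\pi\rfloor$ and $|\rho|\le|\pi|$.
   Context: Resource polynomials: finite sums of finite products $\prod_i\binom{x_i}{n_i}$ (pairwise distinct variables, $n_i\in\mathbb{N}$), read as functions of natural-number variables. A constraint is $p\le q$ for resource polynomials; $p<q$ abbreviates $p+1\le q$; a constraint set is a finite set of constraints. $\Phi\models c$: every assignment of naturals satisfying all of $\Phi$ satisfies $c$; $\Phi\models\Psi$: $\Phi\models c$ for all $c\in\Psi$; $p\sqsubseteq_\Phi q$: $\Phi\models p\le q$. Formulas: $A::=\alpha(p_1,\dots,p_n)\mid A\otimes A\mid A\multimap A\mid\forall\alpha.A\mid\,!_{x<p}A\mid\forall(x_1,\dots,x_n){:}\Phi.A\mid\exists(x_1,\dots,x_n){:}\Phi.A$ ($\alpha$ atoms with fixed arities, $x\notin FV(p)$, and boundedness: for each quantifier formula there are resource polynomials $r_i$ not containing $\overline{x}$ with $\Phi\models\{x_i\le r_i\}_i$). $!_{x<p}$ binds $x$; quantifiers bind $\overline{x}$ in $\Phi$ and body; formulas up to renaming of bound variables; substitutions are capture-avoiding. Polarity: variables of $p_i$ positive in $\alpha(\overline{p})$; in $p\le q$, $p$ negative, $q$ positive; reversed in first argument of $\multimap$, in $p$ of $!_{x<p}$, in the constraint set of $\forall\overline{x}{:}\Phi$; preserved elsewhere. $A\{B/\alpha(x_1,\dots,x_n)\}$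 (for $B$ in which $x_1..x_n$ occur only positively) replaces each free $\alpha(p_1,\dots,p_n)$ by $B\{\overline{p}/\overline{x}\}$. Order: $\alpha(\overline{p})\le_\Phi\alpha(\overline{q})$ iff $p_i\sqsubseteq_\Phi q_i$; $\otimes$ covariant in both; $A\multimap B\le_\Phi C\multimap D$ iff $C\le_\Phi A$, $B\le_\Phi D$; $\forall\alpha.A\le_\Phi\forall\alpha.B$ iff $A\le_\Phi B$; $!_{x<p}A\le_\Phi!_{x<q}B$ iff $q\sqsubseteq_\Phi p$, $x\notin FV(\Phi)$, $A\le_{\Phi\cup\{x<q\}}B$; $\forall\overline{x}{:}\Psi.A\le_\Phi\forall\overline{x}{:}\Theta.B$ iff $\Phi\cup\Theta\models\Psi$, $\overline{x}\notin FV(\Phi)$, $A\le_{\Phi\cup\Theta}B$; $\exists\overline{x}{:}\Psi.A\le_\Phi\exists\overline{x}{:}\Theta.B$ iff $\Phi\cup\Psi\models\Theta$, $\overline{x}\notin FV(\Phi)$, $A\le_{\Phi\cup\Psi}B$. QBAL judgements $\Phi;\Gamma\vdash A$ ($\Gamma$ a multiset of formulas) are derived by the rules: (A) $\Phi;A\vdash B$ if $A\le_\Phi B$. (U) from $\Phi;\Gamma\vdash A$ and $\Phi;\Delta,A\vdash B$ infer $\Phi;\Gamma,\Delta\vdash B$. (W) from $\Phi;\Gamma\vdash B$ infer $\Phi;\Gamma,A\vdash B$. (X) from $\Phi;\Gamma,!_{x<p}A,!_{y<q}A\{p+y/x\}\vdash B$ and $p+q\sqsubseteq_\Phi r$ infer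 $\Phi;\Gamma,!_{x<r}A\vdash B$. ($R_\multimap$) from $\Phi;\Gamma,A\vdash B$ infer $\Phi;\Gamma\vdash A\multimap B$. ($L_\multimap$) from $\Phi;\Gamma\vdash A$ and $\Phi;\Delta,B\vdash C$ infer $\Phi;\Gamma,\Delta,A\multimap B\vdash C$. ($R_\otimes$) from $\Phi;\Gamma\vdash A$ and $\Phi;\Delta\vdash B$ infer $\Phi;\Gamma,\Delta\vdash A\otimes B$. ($L_\otimes$) from $\Phi;\Gamma,A,B\vdash C$ infer $\Phi;\Gamma,A\otimes B\vdash C$. ($P_!$) from $\Phi;A_1,\dots,A_n\vdash B$, with $\Psi\cup\{x<p\}\models\Phi$, $x\notin FV(\Psi)$ and $p\sqsubseteq_\Psi q_i$ for all $i$, infer $\Psi;!_{x<q_1}A_1,\dots,!_{x<q_n}A_n\vdash\,!_{x<p}B$. ($D_!$) from $\Phi;A\{1/x\},\Gamma\vdash B$ and $1\sqsubseteq_\Phi p$ infer $\Phi;!_{x<p}A,\Gamma\vdash B$. ($N_!$) from $\Phi;!_{y<p}!_{z<q\{y/w\}}A\{(z+\sum_{w<y}q)/x\},\Gamma\vdash B$ and $\sum_{w<p}q\sqsubseteq_\Phi r$ infer $\Phi;!_{x<r}A,\Gamma\vdash B$. ($R_{\forall\alpha}$) from $\Phi;\Gamma\vdash A$, $\alpha$ not free in $\Gamma$, infer $\Phi;\Gamma\vdash\forall\alpha.A$. ($L_{\forall\alpha}$) from $\Phi;\Gamma,A\{B/\alpha(x_1,\dots,x_n)\}\vdash C$ infer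 $\Phi;\Gamma,\forall\alpha.A\vdash C$. ($R_{\forall x}$) from $\Phi\cup\Psi;\Gamma\vdash A$, $\overline{x}\notin FV(\Gamma)\cup FV(\Phi)$, infer $\Phi;\Gamma\vdash\forall\overline{x}{:}\Psi.A$. ($L_{\forall x}$) from $\Phi;\Gamma,A\{\overline{p}/\overline{x}\}\vdash C$ and $\Phi\models\Psi\{\overline{p}/\overline{x}\}$ infer $\Phi;\Gamma,\forall\overline{x}{:}\Psi.A\vdash C$. ($R_{\exists x}$) from $\Phi;\Gamma\vdash A\{\overline{p}/\overline{x}\}$ and $\Phi\models\Psi\{\overline{p}/\overline{x}\}$ infer $\Phi;\Gamma\vdash\exists\overline{x}{:}\Psi.A$. ($L_{\exists x}$) from $\Phi\cup\Psi;\Gamma,A\vdash C$, $\overline{x}\notin FV(\Gamma)\cup FV(C)\cup FV(\Phi)$, infer $\Phi;\Gamma,\exists\overline{x}{:}\Psi.A\vdash C$. $|\pi|$ is the number of rule instances in $\pi$. Erasure: formulas erase to second-order intuitionistic propositional formulas by $\alpha(\overline{p})\mapsto\alpha$, $\otimes\mapsto\wedge$, $\multimap\mapsto\to$, $\forall\alpha\mapsto\forall\alpha$, and $!_{x<p}A$, $\forall\overline{x}{:}\Phi.A$, $\exists\overline{x}{:}\Phi.A\mapsto$ erasure of $A$. $\lfloor\pi\rfloor$ is the proof in the sequent calculus for second-order intuitionistic propositional logic (axiom, cut, weakening, contraction, left/right rules for $\to,\wedge,\forall\alpha$) obtained by erasing every formula, dropping constraint sets, deleting every instance of $P_!,D_!,N_!,R_{\forall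 x},L_{\forall x},R_{\exists x},L_{\exists x}$ (whose erased premise equals the erased conclusion), and mapping A, U, W, X, $R/L_\multimap$, $R/L_\otimes$, $R/L_{\forall\alpha}$ to axiom, cut, weakening, contraction, $R/L_\to$, $R/L_\wedge$, $R/L_\forall$. -}

module Defs where

-- Index (first-order) variables are de Bruijn indices into a scope  n
-- (Fin n); second-order atoms are de Bruijn indices into a list Δ of arities.
-- "Up to renaming of bound variables" is thereby built in, and side
-- conditions "x ∉ FV(...)" are enforced by scoping.

open import Data.Nat using (ℕ; zero; suc; _+_; _*_; _≤_)
open import Data.Nat.Combinatorics using (_C_)
open import Data.Fin using (Fin; zero; suc; _↑ˡ_; _↑ʳ_; splitAt)
open import Data.Fin.Properties using (splitAt-↑ˡ; splitAt-↑ʳ)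
open import Data.Sum using (inj₁; inj₂; [_,_])
open import Data.Product using (Σ; _×_; _,_; proj₁; proj₂)
open import Data.Bool using (Bool; true; false; not)
open import Data.List using (List; []; _∷_; _++_; map)
open import Data.List.Relation.Unary.All using (All; []; _∷_)
import Data.List.Relation.Unary.All as All
open import Data.List.Relation.Unary.All.Properties using (map⁻)
open import Data.List.Membership.Propositional using (_∈_)
open import Data.List.Relation.Binary.Permutation.Propositional using (_↭_)
open import Data.Vec using (Vec; lookup; tabulate)
import Data.Vec as Vec
open import Relation.Nullary using (¬_)
open import Relation.Binary.PropositionalEquality
  using (_≡_; refl; sym; trans; cong; cong₂; subst)

-- Every constructor denotes a resource polynomial and every resource
-- polynomial  Σ Π binom(x_i, n_i)  is denoted by an expression built from
-- var, bin, lit, _⊕_, _⊛_.  The extra constructors (bin of a compound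
-- polynomial, bounded sum Σ<) are needed so that substitution p{q/x} and
-- the sum  Σ_{w<p} q  of rule N_! stay inside the syntax; resource
-- polynomials are closed under these operations.

data Poly (n : ℕ) : Set where
  var : Fin n → Poly n
  lit : ℕ → Poly n
  _⊕_ : Poly n → Poly n → Poly n
  _⊛_ : Poly n → Poly n → Poly n
  bin : Poly n → ℕ → Poly n
  Σ<  : Poly n → Poly (suc n) → Poly n      -- Σ_{w<p} q   (w bound, = var zero in q)

Asg : ℕ → Set
Asg n = Fin n → ℕ

_∷ₐ_ : ∀ {n} → ℕ → Asg n → Asg (suc n)
(w ∷ₐ ρ) zero    = w
(w ∷ₐ ρ) (suc i) = ρ i

sumBelow : ℕ → (ℕ → ℕ) → ℕ
sumBelow zero    f = 0
sumBelow (suc p) f = sumBelow p f + f p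

⟦_⟧ : ∀ {n} → Poly n → Asg n → ℕ
⟦ var x ⟧   ρ = ρ x
⟦ lit k ⟧   ρ = k
⟦ p ⊕ q ⟧   ρ = ⟦ p ⟧ ρ + ⟦ q ⟧ ρ
⟦ p ⊛ q ⟧   ρ = ⟦ p ⟧ ρ * ⟦ q ⟧ ρ
⟦ bin p k ⟧ ρ = ⟦ p ⟧ ρ C k
⟦ Σ< p q ⟧  ρ = sumBelow (⟦ p ⟧ ρ) (λ w → ⟦ q ⟧ (w ∷ₐ ρ))

liftR : ∀ {n m} → (Fin n → Fin m) → Fin (suc n) → Fin (suc m)
liftR r zero    = zero
liftR r (suc i) = suc (r i)

renP : ∀ {n m} → (Fin n → Fin m) → Poly n → Poly m
renP r (var x)   = var (r x)
renP r (lit k)   = lit k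
renP r (p ⊕ q)   = renP r p ⊕ renP r q
renP r (p ⊛ q)   = renP r p ⊛ renP r q
renP r (bin p k) = bin (renP r p) k
renP r (Σ< p q)  = Σ< (renP r p) (renP (liftR r) q)

lift1 : ∀ {n m} → (Fin n → Poly m) → Fin (suc n) → Poly (suc m)
lift1 σ zero    = var zero
lift1 σ (suc i) = renP suc (σ i)

substP : ∀ {n m} → (Fin n → Poly m) → Poly n → Poly m
substP σ (var x)   = σ x
substP σ (lit k)   = lit k
substP σ (p ⊕ q)   = substP σ p ⊕ substP σ q
substP σ (p ⊛ q)   = substP σ p ⊛ substP σ q
substP σ (bin p k) = bin (substP σ p) k
substP σ (Σ< p q)  = Σ< (substP σ p) (substP (lift1 σ) q)

-- lifting a substitution under k new binders (new variables come first)
liftP : ∀ k {n m} → (Fin n → Poly m) → Fin (k + n) → Poly (k + m)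
liftP k {n} {m} σ i = [ (λ j → var (j ↑ˡ m)) , (λ j → renP (k ↑ʳ_) (σ j)) ] (splitAt k i)

inst : ∀ {k n} → Vec (Poly n) k → Fin (k + n) → Poly n
inst {k} ps i = [ lookup ps , var ] (splitAt k i)

data Con (n : ℕ) : Set where
  _≤ᶜ_ : Poly n → Poly n → Con n

_<ᶜ_ : ∀ {n} → Poly n → Poly n → Con n
p <ᶜ q = (p ⊕ lit 1) ≤ᶜ q

CSet : ℕ → Set
CSet n = List (Con n)

sat : ∀ {n} → Asg n → Con n → Set
sat ρ (p ≤ᶜ q) = ⟦ p ⟧ ρ ≤ ⟦ q ⟧ ρ

_⊨_ : ∀ {n} → CSet n → Con n → Set
Φ ⊨ c = ∀ ρ → All (sat ρ) Φ → sat ρ c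

_⊨*_ : ∀ {n} → CSet n → CSet n → Set
Φ ⊨* Ψ = All (Φ ⊨_) Ψ

_⊑[_]_ : ∀ {n} → Poly n → CSet n → Poly n → Set
p ⊑[ Φ ] q = Φ ⊨ (p ≤ᶜ q)

substC : ∀ {n m} → (Fin n → Poly m) → Con n → Con m
substC σ (p ≤ᶜ q) = substP σ p ≤ᶜ substP σ q

substCS : ∀ {n m} → (Fin n → Poly m) → CSet n → CSet m
substCS σ = map (substC σ)

wkP : ∀ k {n} → Poly n → Poly (k + n)
wkP k = renP (k ↑ʳ_)

wkCS : ∀ k {n} → CSet n → CSet (k + n)
wkCS k = substCS (λ i → var (k ↑ʳ i))

Bounded : ∀ k {n} → CSet (k + n) → Set
Bounded k {n} Φ = Σ (Fin k → Poly n) λ r → ∀ i → Φ ⊨ (var (i ↑ˡ n) ≤ᶜ wkP k (r i))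

sumBelow-cong : ∀ p {f g : ℕ → ℕ} → (∀ w → f w ≡ g w) → sumBelow p f ≡ sumBelow p g
sumBelow-cong zero    eq = refl
sumBelow-cong (suc p) eq = cong₂ _+_ (sumBelow-cong p eq) (eq p)

eval-cong : ∀ {n} (p : Poly n) {ρ ρ' : Asg n} → (∀ i → ρ i ≡ ρ' i) → ⟦ p ⟧ ρ ≡ ⟦ p ⟧ ρ'
eval-cong (var x)   eq = eq x
eval-cong (lit k)   eq = refl
eval-cong (p ⊕ q)   eq = cong₂ _+_ (eval-cong p eq) (eval-cong q eq)
eval-cong (p ⊛ q)   eq = cong₂ _*_ (eval-cong p eq) (eval-cong q eq)
eval-cong (bin p k) eq = cong (_C k) (eval-cong p eq)
eval-cong (Σ< p q) {ρ} {ρ'} eq =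
  trans (cong (λ v → sumBelow v (λ w → ⟦ q ⟧ (w ∷ₐ ρ))) (eval-cong p eq))
        (sumBelow-cong (⟦ p ⟧ ρ') (λ w → eval-cong q (ext w)))
  where
  ext : ∀ w i → (w ∷ₐ ρ) i ≡ (w ∷ₐ ρ') i
  ext w zero    = refl
  ext w (suc i) = eq i

eval-ren : ∀ {n m} (r : Fin n → Fin m) (p : Poly n) (ρ : Asg m) →
           ⟦ renP r p ⟧ ρ ≡ ⟦ p ⟧ (λ i → ρ (r i))
eval-ren r (var x)   ρ = refl
eval-ren r (lit k)   ρ = refl
eval-ren r (p ⊕ q)   ρ = cong₂ _+_ (eval-ren r p ρ) (eval-ren r q ρ)
eval-ren r (p ⊛ q)   ρ = cong₂ _*_ (eval-ren r p ρ) (eval-ren r q ρ)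
eval-ren r (bin p k) ρ = cong (_C k) (eval-ren r p ρ)
eval-ren r (Σ< p q)  ρ =
  trans (cong (λ v → sumBelow v (λ w → ⟦ renP (liftR r) q ⟧ (w ∷ₐ ρ))) (eval-ren r p ρ))
        (sumBelow-cong (⟦ p ⟧ (λ i → ρ (r i)))
          (λ w → trans (eval-ren (liftR r) q (w ∷ₐ ρ)) (eval-cong q (ext w))))
  where
  ext : ∀ w i → (w ∷ₐ ρ) (liftR r i) ≡ (w ∷ₐ (λ j → ρ (r j))) i
  ext w zero    = refl
  ext w (suc i) = refl

eval-subst : ∀ {n m} (σ : Fin n → Poly m) (p : Poly n) (ρ : Asg m) →
             ⟦ substP σ p ⟧ ρ ≡ ⟦ p ⟧ (λ i → ⟦ σ i ⟧ ρ)
eval-subst σ (var x)   ρ = refl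
eval-subst σ (lit k)   ρ = refl
eval-subst σ (p ⊕ q)   ρ = cong₂ _+_ (eval-subst σ p ρ) (eval-subst σ q ρ)
eval-subst σ (p ⊛ q)   ρ = cong₂ _*_ (eval-subst σ p ρ) (eval-subst σ q ρ)
eval-subst σ (bin p k) ρ = cong (_C k) (eval-subst σ p ρ)
eval-subst σ (Σ< p q)  ρ =
  trans (cong (λ v → sumBelow v (λ w → ⟦ substP (lift1 σ) q ⟧ (w ∷ₐ ρ))) (eval-subst σ p ρ))
        (sumBelow-cong (⟦ p ⟧ (λ i → ⟦ σ i ⟧ ρ))
          (λ w → trans (eval-subst (lift1 σ) q (w ∷ₐ ρ)) (eval-cong q (ext w))))
  where
  ext : ∀ w i → ⟦ lift1 σ i ⟧ (w ∷ₐ ρ) ≡ (w ∷ₐ (λ j → ⟦ σ j ⟧ ρ)) i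
  ext w zero    = refl
  ext w (suc i) = eval-ren suc (σ i) (w ∷ₐ ρ)

sat-subst : ∀ {n m} (σ : Fin n → Poly m) (c : Con n) (ρ : Asg m) →
            sat ρ (substC σ c) → sat (λ i → ⟦ σ i ⟧ ρ) c
sat-subst σ (p ≤ᶜ q) ρ h =
  subst₂' (eval-subst σ p ρ) (eval-subst σ q ρ) h
  where
  subst₂' : ∀ {a b c d : ℕ} → a ≡ b → c ≡ d → a ≤ c → b ≤ d
  subst₂' refl refl h = h

bounded-subst : ∀ k {n m} (σ : Fin n → Poly m) (Ψ : CSet (k + n)) →
                Bounded k Ψ → Bounded k (substCS (liftP k σ) Ψ)
bounded-subst k {n} {m} σ Ψ (r , h) = (λ i → substP σ (r i)) , goal
  where
  goal : ∀ i → substCS (liftP k σ) Ψ ⊨ (var (i ↑ˡ m) ≤ᶜ wkP k (substP σ (r i)))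
  goal i ρ sρ = subst₂' lhs rhs hi
    where
    ρ' : Asg (k + n)
    ρ' j = ⟦ liftP k σ j ⟧ ρ
    sρ' : All (sat ρ') Ψ
    sρ' = All.map (λ {c} → sat-subst (liftP k σ) c ρ) (map⁻ sρ)
    hi : ⟦ var (i ↑ˡ n) ⟧ ρ' ≤ ⟦ wkP k (r i) ⟧ ρ'
    hi = h i ρ' sρ'
    lhs : ⟦ var (i ↑ˡ n) ⟧ ρ' ≡ ρ (i ↑ˡ m)
    lhs rewrite splitAt-↑ˡ k i n = refl
    pt : ∀ j → ρ' (k ↑ʳ j) ≡ ⟦ σ j ⟧ (λ l → ρ (k ↑ʳ l))
    pt j rewrite splitAt-↑ʳ k n j = eval-ren (k ↑ʳ_) (σ j) ρ
    rhs : ⟦ wkP k (r i) ⟧ ρ' ≡ ⟦ wkP k (substP σ (r i)) ⟧ ρ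
    rhs = trans (eval-ren (k ↑ʳ_) (r i) ρ')
           (trans (eval-cong (r i) pt)
             (sym (trans (eval-ren (k ↑ʳ_) (substP σ (r i)) ρ)
                         (eval-subst σ (r i) (λ l → ρ (k ↑ʳ l))))))
    subst₂' : ∀ {a b c d : ℕ} → a ≡ b → c ≡ d → a ≤ c → b ≤ d
    subst₂' refl refl h = h

data _∋_ : List ℕ → ℕ → Set where
  here  : ∀ {k Δ} → (k ∷ Δ) ∋ k
  there : ∀ {j k Δ} → Δ ∋ k → (j ∷ Δ) ∋ k

∋-toℕ : ∀ {Δ k} → Δ ∋ k → ℕ
∋-toℕ here      = zero
∋-toℕ (there v) = suc (∋-toℕ v)

infixr 6 _⊗_
infixr 5 _⊸_

data Fm (Δ : List ℕ) (n : ℕ) : Set where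
  atom : ∀ {k} → Δ ∋ k → Vec (Poly n) k → Fm Δ n
  _⊗_  : Fm Δ n → Fm Δ n → Fm Δ n
  _⊸_  : Fm Δ n → Fm Δ n → Fm Δ n
  ∀α   : (k : ℕ) → Fm (k ∷ Δ) n → Fm Δ n
  !<   : Poly n → Fm Δ (suc n) → Fm Δ n                        -- !_{x<p} A, x = var zero
  ∀x   : (k : ℕ) (Ψ : CSet (k + n)) .(b : Bounded k Ψ) → Fm Δ (k + n) → Fm Δ n
  ∃x   : (k : ℕ) (Ψ : CSet (k + n)) .(b : Bounded k Ψ) → Fm Δ (k + n) → Fm Δ n
  -- ∀(x₁..x_k):Ψ.A and ∃(x₁..x_k):Ψ.A ; x_i = var (i ↑ˡ n)

substF : ∀ {Δ n m} → (Fin n → Poly m) → Fm Δ n → Fm Δ m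
substF σ (atom v ps)  = atom v (Vec.map (substP σ) ps)
substF σ (A ⊗ B)      = substF σ A ⊗ substF σ B
substF σ (A ⊸ B)      = substF σ A ⊸ substF σ B
substF σ (∀α k A)     = ∀α k (substF σ A)
substF σ (!< p A)     = !< (substP σ p) (substF (liftP 1 σ) A)
substF σ (∀x k Ψ b A) = ∀x k (substCS (liftP k σ) Ψ) (bounded-subst k σ Ψ b) (substF (liftP k σ) A)
substF σ (∃x k Ψ b A) = ∃x k (substCS (liftP k σ) Ψ) (bounded-subst k σ Ψ b) (substF (liftP k σ) A)

wkF : ∀ k {Δ n} → Fm Δ n → Fm Δ (k + n)
wkF k = substF (λ i → var (k ↑ʳ i))

renA : ∀ {Δ Δ' n} → (∀ {k} → Δ ∋ k → Δ' ∋ k) → Fm Δ n → Fm Δ' n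
renA r (atom v ps)  = atom (r v) ps
renA r (A ⊗ B)      = renA r A ⊗ renA r B
renA r (A ⊸ B)      = renA r A ⊸ renA r B
renA r (∀α k A)     = ∀α k (renA (λ { here → here ; (there v) → there (r v) }) A)
renA r (!< p A)     = !< p (renA r A)
renA r (∀x k Ψ b A) = ∀x k Ψ b (renA r A)
renA r (∃x k Ψ b A) = ∃x k Ψ b (renA r A)

wkα : ∀ {j Δ n} → Fm Δ n → Fm (j ∷ Δ) n
wkα = renA there

-- simultaneous substitution of atoms: an atom of arity j is replaced by a
-- formula whose first j index variables are the atom's parameters
ASub : List ℕ → List ℕ → ℕ → Set
ASub Δ Δ' n = ∀ {j} → Δ ∋ j → Fm Δ' (j + n)

-- moving a formula with j parameter variables under k more binders
liftIdx : ∀ j k {n} → Fin (j + n) → Fin (j + (k + n))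
liftIdx j k {n} i = [ (λ a → a ↑ˡ (k + n)) , (λ b → j ↑ʳ (k ↑ʳ b)) ] (splitAt j i)

substA : ∀ {Δ Δ' n} → ASub Δ Δ' n → Fm Δ n → Fm Δ' n
substA σ (atom {j} v ps) = substF (inst ps) (σ v)
substA σ (A ⊗ B)      = substA σ A ⊗ substA σ B
substA σ (A ⊸ B)      = substA σ A ⊸ substA σ B
substA {n = n} σ (∀α k A) = ∀α k (substA σ' A)
  where
  σ' : ASub (k ∷ _) (k ∷ _) n
  σ' here      = atom here (tabulate (λ i → var (i ↑ˡ n)))
  σ' (there v) = wkα (σ v)
substA σ (!< p A)     = !< p (substA (λ {j} v → substF (λ i → var (liftIdx j 1 i)) (σ v)) A)
substA σ (∀x k Ψ b A) = ∀x k Ψ b (substA (λ {j} v → substF (λ i → var (liftIdx j k i)) (σ v)) A)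
substA σ (∃x k Ψ b A) = ∃x k Ψ b (substA (λ {j} v → substF (λ i → var (liftIdx j k i)) (σ v)) A)

-- A{B/α(x₁..x_k)} for the outermost bound atom α (of arity k), with
-- x₁..x_k the first k index variables of B
_[_/α] : ∀ {Δ n k} → Fm (k ∷ Δ) n → Fm Δ (k + n) → Fm Δ n
_[_/α] {Δ} {n} A B = substA σ A
  where
  σ : ASub (_ ∷ Δ) Δ n
  σ here      = B
  σ (there v) = atom v (tabulate (λ i → var (i ↑ˡ n)))

data OccP {n : ℕ} (x : Fin n) : Poly n → Set where
  var  : OccP x (var x)
  ⊕l   : ∀ {p q} → OccP x p → OccP x (p ⊕ q)
  ⊕r   : ∀ {p q} → OccP x q → OccP x (p ⊕ q)
  ⊛l   : ∀ {p q} → OccP x p → OccP x (p ⊛ q)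
  ⊛r   : ∀ {p q} → OccP x q → OccP x (p ⊛ q)
  bin  : ∀ {p k} → OccP x p → OccP x (bin p k)
  Σ<l  : ∀ {p q} → OccP x p → OccP x (Σ< p q)
  Σ<r  : ∀ {p q} → OccP (suc x) q → OccP x (Σ< p q)

-- OccC s x c : x has an occurrence of polarity s in the constraint c
-- (true = positive); in p ≤ q, p is negative and q positive
data OccC {n : ℕ} : Bool → Fin n → Con n → Set where
  lhs : ∀ {x p q} → OccP x p → OccC false x (p ≤ᶜ q)
  rhs : ∀ {x p q} → OccP x q → OccC true x (p ≤ᶜ q)

data Occ {Δ : List ℕ} {n : ℕ} : Bool → Fin n → Fm Δ n → Set where
  atom : ∀ {x j} {v : Δ ∋ j} {ps} i → OccP x (lookup ps i) → Occ true x (atom v ps)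
  ⊗l   : ∀ {s x A B} → Occ s x A → Occ s x (A ⊗ B)
  ⊗r   : ∀ {s x A B} → Occ s x B → Occ s x (A ⊗ B)
  ⊸l   : ∀ {s x A B} → Occ s x A → Occ (not s) x (A ⊸ B)
  ⊸r   : ∀ {s x A B} → Occ s x B → Occ s x (A ⊸ B)
  ∀αb  : ∀ {s x k A} → Occ {k ∷ Δ} s x A → Occ s x (∀α k A)
  !p   : ∀ {x p A} → OccP x p → Occ false x (!< p A)
  !b   : ∀ {s x p A} → Occ s (suc x) A → Occ s x (!< p A)
  ∀xc  : ∀ {s x k Ψ A c} .{b} → c ∈ Ψ → OccC s (k ↑ʳ x) c → Occ (not s) x (∀x k Ψ b A)
  ∀xb  : ∀ {s x k Ψ A} .{b} → Occ s (k ↑ʳ x) A → Occ s x (∀x k Ψ b A)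
  ∃xc  : ∀ {s x k Ψ A c} .{b} → c ∈ Ψ → OccC s (k ↑ʳ x) c → Occ s x (∃x k Ψ b A)
  ∃xb  : ∀ {s x k Ψ A} .{b} → Occ s (k ↑ʳ x) A → Occ s x (∃x k Ψ b A)

OnlyPos : ∀ {Δ n} → Fin n → Fm Δ n → Set
OnlyPos x A = ¬ Occ false x A

data _≤[_]_ {Δ : List ℕ} {n : ℕ} : Fm Δ n → CSet n → Fm Δ n → Set where
  atom≤ : ∀ {Φ j} (v : Δ ∋ j) {ps qs : Vec (Poly n) j} →
          (∀ i → lookup ps i ⊑[ Φ ] lookup qs i) → atom v ps ≤[ Φ ] atom v qs
  ⊗≤    : ∀ {Φ A B C D} → A ≤[ Φ ] C → B ≤[ Φ ] D → (A ⊗ B) ≤[ Φ ] (C ⊗ D)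
  ⊸≤    : ∀ {Φ A B C D} → C ≤[ Φ ] A → B ≤[ Φ ] D → (A ⊸ B) ≤[ Φ ] (C ⊸ D)
  ∀α≤   : ∀ {Φ k A B} → _≤[_]_ {k ∷ Δ} A Φ B → ∀α k A ≤[ Φ ] ∀α k B
  !≤    : ∀ {Φ p q A B} → q ⊑[ Φ ] p →
          A ≤[ wkCS 1 Φ ++ (var zero <ᶜ wkP 1 q) ∷ [] ] B → !< p A ≤[ Φ ] !< q B
  ∀x≤   : ∀ {Φ k Ψ Θ A B} .{b b'} → (wkCS k Φ ++ Θ) ⊨* Ψ →
          A ≤[ wkCS k Φ ++ Θ ] B → ∀x k Ψ b A ≤[ Φ ] ∀x k Θ b' B
  ∃x≤   : ∀ {Φ k Ψ Θ A B} .{b b'} → (wkCS k Φ ++ Ψ) ⊨* Θ →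
          A ≤[ wkCS k Φ ++ Ψ ] B → ∃x k Ψ b A ≤[ Φ ] ∃x k Θ b' B

-- QBAL derivations  Φ ; Γ ⊢ B
-- Contexts are multisets: each rule's conclusion context Γc is any
-- permutation (↭) of the listed context.

σX : ∀ {n} → Poly n → Fin (suc n) → Poly (suc n)     -- A{p+y/x} under !_{y<q}
σX p zero    = wkP 1 p ⊕ var zero
σX p (suc i) = var (suc i)

σD : ∀ {n} → Fin (suc n) → Poly n
σD zero    = lit 1
σD (suc i) = var i

-- A{(z + Σ_{w<y} q)/x} under !_{y<p} !_{z<q{y/w}}  (z = var 0, y = var 1)
σN : ∀ {n} → Poly (suc n) → Fin (suc n) → Poly (suc (suc n))
σN q zero    = var zero ⊕ Σ< (var (suc zero)) (renP ρq q)
  where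
  ρq : ∀ {n} → Fin (suc n) → Fin (suc (suc (suc n)))
  ρq zero    = zero
  ρq (suc i) = suc (suc (suc i))
σN q (suc i) = var (suc (suc i))

infix 3 _︔_⊢_

data _︔_⊢_ {Δ : List ℕ} {n : ℕ} : CSet n → List (Fm Δ n) → Fm Δ n → Set where
  ax   : ∀ {Φ Γc A B} → A ≤[ Φ ] B → Γc ↭ A ∷ [] → Φ ︔ Γc ⊢ B
  cut  : ∀ {Φ Γ Δ' Γc A B} → Φ ︔ Γ ⊢ A → Φ ︔ A ∷ Δ' ⊢ B → Γc ↭ Γ ++ Δ' → Φ ︔ Γc ⊢ B
  weak : ∀ {Φ Γ Γc A B} → Φ ︔ Γ ⊢ B → Γc ↭ A ∷ Γ → Φ ︔ Γc ⊢ B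
  contr : ∀ {Φ Γ Γc p q r A B} →
          Φ ︔ !< p A ∷ !< q (substF (σX p) A) ∷ Γ ⊢ B → (p ⊕ q) ⊑[ Φ ] r →
          Γc ↭ !< r A ∷ Γ → Φ ︔ Γc ⊢ B
  R⊸   : ∀ {Φ Γ Γc A B} → Φ ︔ A ∷ Γ ⊢ B → Γc ↭ Γ → Φ ︔ Γc ⊢ A ⊸ B
  L⊸   : ∀ {Φ Γ Δ' Γc A B C} → Φ ︔ Γ ⊢ A → Φ ︔ B ∷ Δ' ⊢ C →
         Γc ↭ (A ⊸ B) ∷ Γ ++ Δ' → Φ ︔ Γc ⊢ C
  R⊗   : ∀ {Φ Γ Δ' Γc A B} → Φ ︔ Γ ⊢ A → Φ ︔ Δ' ⊢ B → Γc ↭ Γ ++ Δ' → Φ ︔ Γc ⊢ A ⊗ B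
  L⊗   : ∀ {Φ Γ Γc A B C} → Φ ︔ A ∷ B ∷ Γ ⊢ C → Γc ↭ (A ⊗ B) ∷ Γ → Φ ︔ Γc ⊢ C
  -- (P!) : premise Φ' ; A₁..A_m ⊢ B ; conclusion Ψ ; !_{x<q_i}A_i ⊢ !_{x<p}B
  P!   : ∀ {Ψ Γc p} {Φ' : CSet (suc n)} {B} (AQs : List (Poly n × Fm Δ (suc n))) →
         Φ' ︔ map proj₂ AQs ⊢ B →
         (wkCS 1 Ψ ++ (var zero <ᶜ wkP 1 p) ∷ []) ⊨* Φ' →
         All (λ qA → p ⊑[ Ψ ] proj₁ qA) AQs →
         Γc ↭ map (λ qA → !< (proj₁ qA) (proj₂ qA)) AQs → Ψ ︔ Γc ⊢ !< p B
  D!   : ∀ {Φ Γ Γc p A B} → Φ ︔ substF σD A ∷ Γ ⊢ B → lit 1 ⊑[ Φ ] p →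
         Γc ↭ !< p A ∷ Γ → Φ ︔ Γc ⊢ B
  N!   : ∀ {Φ Γ Γc p r A B} {q : Poly (suc n)} →
         Φ ︔ !< p (!< q (substF (σN q) A)) ∷ Γ ⊢ B → Σ< p q ⊑[ Φ ] r →
         Γc ↭ !< r A ∷ Γ → Φ ︔ Γc ⊢ B
  R∀α  : ∀ {Φ Γ Γc k A} → _︔_⊢_ {k ∷ Δ} Φ (map wkα Γ) A → Γc ↭ Γ → Φ ︔ Γc ⊢ ∀α k A
  L∀α  : ∀ {Φ Γ Γc k C} {A : Fm (k ∷ Δ) n} (B : Fm Δ (k + n)) →
         (∀ i → OnlyPos (i ↑ˡ n) B) →
         Φ ︔ (A [ B /α]) ∷ Γ ⊢ C → Γc ↭ ∀α k A ∷ Γ → Φ ︔ Γc ⊢ C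
  R∀x  : ∀ {Φ Γ Γc k Ψ A} .{b} → wkCS k Φ ++ Ψ ︔ map (wkF k) Γ ⊢ A → Γc ↭ Γ →
         Φ ︔ Γc ⊢ ∀x k Ψ b A
  L∀x  : ∀ {Φ Γ Γc k Ψ A C} .{b} (ps : Vec (Poly n) k) →
         Φ ︔ substF (inst ps) A ∷ Γ ⊢ C → Φ ⊨* substCS (inst ps) Ψ →
         Γc ↭ ∀x k Ψ b A ∷ Γ → Φ ︔ Γc ⊢ C
  R∃x  : ∀ {Φ Γ Γc k Ψ A} .{b} (ps : Vec (Poly n) k) →
         Φ ︔ Γ ⊢ substF (inst ps) A → Φ ⊨* substCS (inst ps) Ψ →
         Γc ↭ Γ → Φ ︔ Γc ⊢ ∃x k Ψ b A
  L∃x  : ∀ {Φ Γ Γc k Ψ A C} .{b} → wkCS k Φ ++ Ψ ︔ A ∷ map (wkF k) Γ ⊢ wkF k C →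
         Γc ↭ ∃x k Ψ b A ∷ Γ → Φ ︔ Γc ⊢ C

size : ∀ {Δ n} {Φ : CSet n} {Γ : List (Fm Δ n)} {B} → Φ ︔ Γ ⊢ B → ℕ
size (ax _ _)            = 1
size (cut π π' _)        = suc (size π + size π')
size (weak π _)          = suc (size π)
size (contr π _ _)       = suc (size π)
size (R⊸ π _)            = suc (size π)
size (L⊸ π π' _)         = suc (size π + size π')
size (R⊗ π π' _)         = suc (size π + size π')
size (L⊗ π _)            = suc (size π)
size (P! _ π _ _ _)      = suc (size π)
size (D! π _ _)          = suc (size π)
size (N! π _ _)          = suc (size π)
size (R∀α π _)           = suc (size π)
size (L∀α _ _ π _)       = suc (size π)
size (R∀x π _)           = suc (size π)
size (L∀x _ π _ _)       = suc (size π)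
size (R∃x _ π _ _)       = suc (size π)
size (L∃x π _)           = suc (size π)

-- formulas (propositional variables as de Bruijn indices)
data SFm : Set where
  svar : ℕ → SFm
  _∧ˢ_ : SFm → SFm → SFm
  _⇒ˢ_ : SFm → SFm → SFm
  ∀ˢ   : SFm → SFm

eraseF : ∀ {Δ n} → Fm Δ n → SFm
eraseF (atom v ps)  = svar (∋-toℕ v)
eraseF (A ⊗ B)      = eraseF A ∧ˢ eraseF B
eraseF (A ⊸ B)      = eraseF A ⇒ˢ eraseF B
eraseF (∀α k A)     = ∀ˢ (eraseF A)
eraseF (!< p A)     = eraseF A
eraseF (∀x k Ψ b A) = eraseF A
eraseF (∃x k Ψ b A) = eraseF A

-- sequents  Γ ⊢ A  (Γ a multiset, represented by a list)
Seq : Set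
Seq = List SFm × SFm

data Rule : Set where
  axiomR cutR weakR contrR R→ L→ R∧ L∧ R∀ L∀ : Rule

data SProof : Set where
  node : Rule → Seq → List SProof → SProof

mutual
  data _≋_ : SProof → SProof → Set where
    node : ∀ {r Γ Γ' A ts ts'} → Γ ↭ Γ' → Pointwise≋ ts ts' →
           node r (Γ , A) ts ≋ node r (Γ' , A) ts'

  data Pointwise≋ : List SProof → List SProof → Set where
    []  : Pointwise≋ [] []
    _∷_ : ∀ {t t' ts ts'} → t ≋ t' → Pointwise≋ ts ts' → Pointwise≋ (t ∷ ts) (t' ∷ ts')

erase : ∀ {Δ n} {Φ : CSet n} {Γ : List (Fm Δ n)} {B} → Φ ︔ Γ ⊢ B → SProof
erase {Γ = Γ} {B} π = go π
  where
  sq : Seq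
  sq = map eraseF Γ , eraseF B
  go : _ → SProof
  go (ax _ _)         = node axiomR sq []
  go (cut π π' _)     = node cutR sq (erase π ∷ erase π' ∷ [])
  go (weak π _)       = node weakR sq (erase π ∷ [])
  go (contr π _ _)    = node contrR sq (erase π ∷ [])
  go (R⊸ π _)         = node R→ sq (erase π ∷ [])
  go (L⊸ π π' _)      = node L→ sq (erase π ∷ erase π' ∷ [])
  go (R⊗ π π' _)      = node R∧ sq (erase π ∷ erase π' ∷ [])
  go (L⊗ π _)         = node L∧ sq (erase π ∷ [])
  go (P! _ π _ _ _)   = erase π
  go (D! π _ _)       = erase π
  go (N! π _ _)       = erase π
  go (R∀α π _)        = node R∀ sq (erase π ∷ [])
  go (L∀α _ _ π _)    = node L∀ sq (erase π ∷ [])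
  go (R∀x π _)        = erase π
  go (L∀x _ π _ _)    = erase π
  go (R∃x _ π _ _)    = erase π
  go (L∃x π _)        = erase π

-- Every side condition of a QBAL rule that mentions the constraint set Φ is an
-- entailment Φ ⊨ c or Φ ⊨* Θ, an order judgement A ≤[ Φ ] B, or such a condition
-- over wkCS k Φ ++ Θ; all of them stay true when Φ is replaced by a stronger Ψ.
-- So the same rules apply to the same formulas, giving a derivation of identical
-- shape, hence with the same erasure and size.  The premise of P! is checked
-- under its own constraint set, which is related to Φ only through an
-- entailment, so that premise is reused verbatim.
module Submission where

open import Defs
open import Data.Nat using (ℕ; suc; _≤_; _+_)
open import Data.Nat.Properties using (≤-reflexive)
open import Data.List using (List; []; _∷_; _++_)
open import Data.Product using (Σ; _×_; _,_; proj₁)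
open import Data.Fin using (Fin)
import Data.Vec as Vec
open import Data.List.Relation.Unary.All using (All; []; _∷_)
import Data.List.Relation.Unary.All as All
open import Data.List.Relation.Unary.All.Properties using (map⁻; map⁺; ++⁺; ++⁻ˡ; ++⁻ʳ)
open import Data.List.Relation.Binary.Permutation.Propositional using (↭-refl)
open import Relation.Binary.PropositionalEquality
  using (_≡_; refl; sym; cong; cong₂; subst₂)

private
  variable
    Δ : List ℕ
    n : ℕ
    Φ Ψ Θ : CSet n

⊨*⇒All-sat : Φ ⊨* Ψ → ∀ ρ → All (sat ρ) Φ → All (sat ρ) Ψ
⊨*⇒All-sat Φ⊨Ψ ρ satΦ = All.map (λ Φ⊨c → Φ⊨c ρ satΦ) Φ⊨Ψ

All-sat⇒⊨* : (∀ ρ → All (sat ρ) Φ → All (sat ρ) Ψ) → Φ ⊨* Ψ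
All-sat⇒⊨* {Ψ = []}    f = []
All-sat⇒⊨* {Ψ = c ∷ Ψ} f =
  (λ ρ satΦ → All.head (f ρ satΦ)) ∷ All-sat⇒⊨* (λ ρ satΦ → All.tail (f ρ satΦ))

⊨-strengthen : ∀ {c : Con n} → Ψ ⊨* Φ → Φ ⊨ c → Ψ ⊨ c
⊨-strengthen Ψ⊨Φ Φ⊨c ρ satΨ = Φ⊨c ρ (⊨*⇒All-sat Ψ⊨Φ ρ satΨ)

⊨*-trans : Ψ ⊨* Φ → Φ ⊨* Θ → Ψ ⊨* Θ
⊨*-trans Ψ⊨Φ = All.map (⊨-strengthen Ψ⊨Φ)

⊑-strengthen : ∀ (p q : Poly n) → Ψ ⊨* Φ → p ⊑[ Φ ] q → p ⊑[ Ψ ] q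
⊑-strengthen p q = ⊨-strengthen {c = p ≤ᶜ q}

sat-substC⁺ : ∀ {m} (σ : Fin n → Poly m) (c : Con n) (ρ : Asg m) →
              sat (λ i → ⟦ σ i ⟧ ρ) c → sat ρ (substC σ c)
sat-substC⁺ σ (p ≤ᶜ q) ρ = subst₂ _≤_ (sym (eval-subst σ p ρ)) (sym (eval-subst σ q ρ))

⊨*-substCS : ∀ {m} (σ : Fin n → Poly m) → Ψ ⊨* Φ → substCS σ Ψ ⊨* substCS σ Φ
⊨*-substCS σ Ψ⊨Φ = All-sat⇒⊨* λ ρ satσΨ →
  map⁺ (All.map (λ {c} → sat-substC⁺ σ c ρ)
    (⊨*⇒All-sat Ψ⊨Φ _ (All.map (λ {c} → sat-subst σ c ρ) (map⁻ satσΨ))))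

⊨*-++ʳ : (Θ : CSet n) → Ψ ⊨* Φ → (Ψ ++ Θ) ⊨* (Φ ++ Θ)
⊨*-++ʳ {Ψ = Ψ} Θ Ψ⊨Φ = All-sat⇒⊨* λ ρ sat →
  ++⁺ (⊨*⇒All-sat Ψ⊨Φ ρ (++⁻ˡ Ψ sat)) (++⁻ʳ Ψ sat)

⊨*-extend : ∀ k (Θ : CSet (k + n)) → Ψ ⊨* Φ → (wkCS k Ψ ++ Θ) ⊨* (wkCS k Φ ++ Θ)
⊨*-extend k Θ Ψ⊨Φ = ⊨*-++ʳ Θ (⊨*-substCS _ Ψ⊨Φ)

≤-strengthen : ∀ {A B : Fm Δ n} → Ψ ⊨* Φ → A ≤[ Φ ] B → A ≤[ Ψ ] B
≤-strengthen Ψ⊨Φ (atom≤ v {ps} {qs} ps⊑qs) =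
  atom≤ v (λ i → ⊑-strengthen (Vec.lookup ps i) (Vec.lookup qs i) Ψ⊨Φ (ps⊑qs i))
≤-strengthen Ψ⊨Φ (⊗≤ A≤C B≤D) = ⊗≤ (≤-strengthen Ψ⊨Φ A≤C) (≤-strengthen Ψ⊨Φ B≤D)
≤-strengthen Ψ⊨Φ (⊸≤ C≤A B≤D) = ⊸≤ (≤-strengthen Ψ⊨Φ C≤A) (≤-strengthen Ψ⊨Φ B≤D)
≤-strengthen Ψ⊨Φ (∀α≤ A≤B)    = ∀α≤ (≤-strengthen Ψ⊨Φ A≤B)
≤-strengthen Ψ⊨Φ (!≤ {p = p} {q = q} q⊑p A≤B) =
  !≤ (⊑-strengthen q p Ψ⊨Φ q⊑p) (≤-strengthen (⊨*-extend 1 _ Ψ⊨Φ) A≤B)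
≤-strengthen Ψ⊨Φ (∀x≤ {k = k} ⊨Ψ A≤B) =
  ∀x≤ (⊨*-trans (⊨*-extend k _ Ψ⊨Φ) ⊨Ψ) (≤-strengthen (⊨*-extend k _ Ψ⊨Φ) A≤B)
≤-strengthen Ψ⊨Φ (∃x≤ {k = k} ⊨Θ A≤B) =
  ∃x≤ (⊨*-trans (⊨*-extend k _ Ψ⊨Φ) ⊨Θ) (≤-strengthen (⊨*-extend k _ Ψ⊨Φ) A≤B)

⊢-strengthen : ∀ {Γ : List (Fm Δ n)} {B} → Ψ ⊨* Φ → Φ ︔ Γ ⊢ B → Ψ ︔ Γ ⊢ B
⊢-strengthen Ψ⊨Φ (ax A≤B perm)            = ax (≤-strengthen Ψ⊨Φ A≤B) perm
⊢-strengthen Ψ⊨Φ (cut π π′ perm)          = cut (⊢-strengthen Ψ⊨Φ π) (⊢-strengthen Ψ⊨Φ π′) perm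
⊢-strengthen Ψ⊨Φ (weak π perm)            = weak (⊢-strengthen Ψ⊨Φ π) perm
⊢-strengthen Ψ⊨Φ (contr {p = p} {q = q} {r = r} π p+q⊑r perm) =
  contr (⊢-strengthen Ψ⊨Φ π) (⊑-strengthen (p ⊕ q) r Ψ⊨Φ p+q⊑r) perm
⊢-strengthen Ψ⊨Φ (R⊸ π perm)              = R⊸ (⊢-strengthen Ψ⊨Φ π) perm
⊢-strengthen Ψ⊨Φ (L⊸ π π′ perm)           = L⊸ (⊢-strengthen Ψ⊨Φ π) (⊢-strengthen Ψ⊨Φ π′) perm
⊢-strengthen Ψ⊨Φ (R⊗ π π′ perm)           = R⊗ (⊢-strengthen Ψ⊨Φ π) (⊢-strengthen Ψ⊨Φ π′) perm
⊢-strengthen Ψ⊨Φ (L⊗ π perm)              = L⊗ (⊢-strengthen Ψ⊨Φ π) perm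
⊢-strengthen Ψ⊨Φ (P! {p = p} AQs π ⊨Φ′ p⊑qs perm) =
  P! AQs π (⊨*-trans (⊨*-extend 1 _ Ψ⊨Φ) ⊨Φ′)
     (All.map (λ {qA} → ⊑-strengthen p (proj₁ qA) Ψ⊨Φ) p⊑qs) perm
⊢-strengthen Ψ⊨Φ (D! {p = p} π 1⊑p perm) =
  D! (⊢-strengthen Ψ⊨Φ π) (⊑-strengthen (lit 1) p Ψ⊨Φ 1⊑p) perm
⊢-strengthen Ψ⊨Φ (N! {p = p} {r = r} {q = q} π Σq⊑r perm) =
  N! (⊢-strengthen Ψ⊨Φ π) (⊑-strengthen (Σ< p q) r Ψ⊨Φ Σq⊑r) perm
⊢-strengthen Ψ⊨Φ (R∀α π perm)             = R∀α (⊢-strengthen Ψ⊨Φ π) perm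
⊢-strengthen Ψ⊨Φ (L∀α B pos π perm)       = L∀α B pos (⊢-strengthen Ψ⊨Φ π) perm
⊢-strengthen Ψ⊨Φ (R∀x {k = k} π perm)     = R∀x (⊢-strengthen (⊨*-extend k _ Ψ⊨Φ) π) perm
⊢-strengthen Ψ⊨Φ (L∀x ps π ⊨Ψ perm)       = L∀x ps (⊢-strengthen Ψ⊨Φ π) (⊨*-trans Ψ⊨Φ ⊨Ψ) perm
⊢-strengthen Ψ⊨Φ (R∃x ps π ⊨Ψ perm)       = R∃x ps (⊢-strengthen Ψ⊨Φ π) (⊨*-trans Ψ⊨Φ ⊨Ψ) perm
⊢-strengthen Ψ⊨Φ (L∃x {k = k} π perm)     = L∃x (⊢-strengthen (⊨*-extend k _ Ψ⊨Φ) π) perm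

private
  cong-suc+ : ∀ {a a′ b b′ : ℕ} → a ≡ a′ → b ≡ b′ → suc (a + b) ≡ suc (a′ + b′)
  cong-suc+ = cong₂ (λ a b → suc (a + b))

  cong-node₁ : ∀ {r sq t t′} → t ≡ t′ → node r sq (t ∷ []) ≡ node r sq (t′ ∷ [])
  cong-node₁ = cong (λ t → node _ _ (t ∷ []))

  cong-node₂ : ∀ {r sq t t′ u u′} → t ≡ t′ → u ≡ u′ →
               node r sq (t ∷ u ∷ []) ≡ node r sq (t′ ∷ u′ ∷ [])
  cong-node₂ = cong₂ (λ t u → node _ _ (t ∷ u ∷ []))

size-⊢-strengthen : ∀ {Γ : List (Fm Δ n)} {B} (Ψ⊨Φ : Ψ ⊨* Φ) (π : Φ ︔ Γ ⊢ B) →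
                    size (⊢-strengthen Ψ⊨Φ π) ≡ size π
size-⊢-strengthen Ψ⊨Φ (ax _ _)          = refl
size-⊢-strengthen Ψ⊨Φ (cut π π′ _)      = cong-suc+ (size-⊢-strengthen Ψ⊨Φ π) (size-⊢-strengthen Ψ⊨Φ π′)
size-⊢-strengthen Ψ⊨Φ (weak π _)        = cong suc (size-⊢-strengthen Ψ⊨Φ π)
size-⊢-strengthen Ψ⊨Φ (contr π _ _)     = cong suc (size-⊢-strengthen Ψ⊨Φ π)
size-⊢-strengthen Ψ⊨Φ (R⊸ π _)          = cong suc (size-⊢-strengthen Ψ⊨Φ π)
size-⊢-strengthen Ψ⊨Φ (L⊸ π π′ _)       = cong-suc+ (size-⊢-strengthen Ψ⊨Φ π) (size-⊢-strengthen Ψ⊨Φ π′)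
size-⊢-strengthen Ψ⊨Φ (R⊗ π π′ _)       = cong-suc+ (size-⊢-strengthen Ψ⊨Φ π) (size-⊢-strengthen Ψ⊨Φ π′)
size-⊢-strengthen Ψ⊨Φ (L⊗ π _)          = cong suc (size-⊢-strengthen Ψ⊨Φ π)
size-⊢-strengthen Ψ⊨Φ (P! _ _ _ _ _)    = refl
size-⊢-strengthen Ψ⊨Φ (D! π _ _)        = cong suc (size-⊢-strengthen Ψ⊨Φ π)
size-⊢-strengthen Ψ⊨Φ (N! π _ _)        = cong suc (size-⊢-strengthen Ψ⊨Φ π)
size-⊢-strengthen Ψ⊨Φ (R∀α π _)         = cong suc (size-⊢-strengthen Ψ⊨Φ π)
size-⊢-strengthen Ψ⊨Φ (L∀α _ _ π _)     = cong suc (size-⊢-strengthen Ψ⊨Φ π)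
size-⊢-strengthen Ψ⊨Φ (R∀x {k = k} π _) = cong suc (size-⊢-strengthen (⊨*-extend k _ Ψ⊨Φ) π)
size-⊢-strengthen Ψ⊨Φ (L∀x _ π _ _)     = cong suc (size-⊢-strengthen Ψ⊨Φ π)
size-⊢-strengthen Ψ⊨Φ (R∃x _ π _ _)     = cong suc (size-⊢-strengthen Ψ⊨Φ π)
size-⊢-strengthen Ψ⊨Φ (L∃x {k = k} π _) = cong suc (size-⊢-strengthen (⊨*-extend k _ Ψ⊨Φ) π)

erase-⊢-strengthen : ∀ {Γ : List (Fm Δ n)} {B} (Ψ⊨Φ : Ψ ⊨* Φ) (π : Φ ︔ Γ ⊢ B) →
                     erase (⊢-strengthen Ψ⊨Φ π) ≡ erase π
erase-⊢-strengthen Ψ⊨Φ (ax _ _)          = refl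
erase-⊢-strengthen Ψ⊨Φ (cut π π′ _)      = cong-node₂ (erase-⊢-strengthen Ψ⊨Φ π) (erase-⊢-strengthen Ψ⊨Φ π′)
erase-⊢-strengthen Ψ⊨Φ (weak π _)        = cong-node₁ (erase-⊢-strengthen Ψ⊨Φ π)
erase-⊢-strengthen Ψ⊨Φ (contr π _ _)     = cong-node₁ (erase-⊢-strengthen Ψ⊨Φ π)
erase-⊢-strengthen Ψ⊨Φ (R⊸ π _)          = cong-node₁ (erase-⊢-strengthen Ψ⊨Φ π)
erase-⊢-strengthen Ψ⊨Φ (L⊸ π π′ _)       = cong-node₂ (erase-⊢-strengthen Ψ⊨Φ π) (erase-⊢-strengthen Ψ⊨Φ π′)
erase-⊢-strengthen Ψ⊨Φ (R⊗ π π′ _)       = cong-node₂ (erase-⊢-strengthen Ψ⊨Φ π) (erase-⊢-strengthen Ψ⊨Φ π′)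
erase-⊢-strengthen Ψ⊨Φ (L⊗ π _)          = cong-node₁ (erase-⊢-strengthen Ψ⊨Φ π)
erase-⊢-strengthen Ψ⊨Φ (P! _ _ _ _ _)    = refl
erase-⊢-strengthen Ψ⊨Φ (D! π _ _)        = erase-⊢-strengthen Ψ⊨Φ π
erase-⊢-strengthen Ψ⊨Φ (N! π _ _)        = erase-⊢-strengthen Ψ⊨Φ π
erase-⊢-strengthen Ψ⊨Φ (R∀α π _)         = cong-node₁ (erase-⊢-strengthen Ψ⊨Φ π)
erase-⊢-strengthen Ψ⊨Φ (L∀α _ _ π _)     = cong-node₁ (erase-⊢-strengthen Ψ⊨Φ π)
erase-⊢-strengthen Ψ⊨Φ (R∀x {k = k} π _) = erase-⊢-strengthen (⊨*-extend k _ Ψ⊨Φ) π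
erase-⊢-strengthen Ψ⊨Φ (L∀x _ π _ _)     = erase-⊢-strengthen Ψ⊨Φ π
erase-⊢-strengthen Ψ⊨Φ (R∃x _ π _ _)     = erase-⊢-strengthen Ψ⊨Φ π
erase-⊢-strengthen Ψ⊨Φ (L∃x {k = k} π _) = erase-⊢-strengthen (⊨*-extend k _ Ψ⊨Φ) π

mutual
  ≋-refl : ∀ t → t ≋ t
  ≋-refl (node _ (_ , _) ts) = node ↭-refl (Pointwise≋-refl ts)

  Pointwise≋-refl : ∀ ts → Pointwise≋ ts ts
  Pointwise≋-refl []       = []
  Pointwise≋-refl (t ∷ ts) = ≋-refl t ∷ Pointwise≋-refl ts

≡⇒≋ : ∀ {t u} → t ≡ u → t ≋ u
≡⇒≋ {t} refl = ≋-refl t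

proposition2p13 : ∀ {Δ : List ℕ} {n : ℕ} {Φ Ψ : CSet n} {Γ : List (Fm Δ n)} {B : Fm Δ n}
    (π : Φ ︔ Γ ⊢ B) → Ψ ⊨* Φ →
    Σ (Ψ ︔ Γ ⊢ B) (λ ρ → (erase ρ ≋ erase π) × (size ρ ≤ size π))
proposition2p13 π Ψ⊨Φ =
  ⊢-strengthen Ψ⊨Φ π ,
  ≡⇒≋ (erase-⊢-strengthen Ψ⊨Φ π) ,
  ≤-reflexive (size-⊢-strengthen Ψ⊨Φ π)
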